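{- Let $c>1$ be an integer. If $(1,c-1,c)$ is an $abc$ triple, then $(1,c^{k}-1,c^{k})$ is an $abc$ triple for each positive integer $k$.
   Context: For a positive integer $n$, $\operatorname{rad}(n)$ denotes the product of the distinct prime factors of $n$. An $abc$ triple is a triple $(a,b,c)$ of relatively prime positive integers with $a+b=c$ and $\operatorname{rad}(abc)<c$. -}

module Defs where

open import Data.Nat using (ℕ; suc; _+_; _*_; _<_; _>_)
open import Data.Nat.Divisibility using (_∣?_)
open import Data.Nat.Primality using (Prime; prime?)
open import Data.Nat.Coprimality using (Coprime)
open import Data.List using (List; filter; upTo)
open import Data.Nat.ListAction using (product)
open import Data.Product using (_×_)
open import Relation.Binary.PropositionalEquality using (_≡_)
open import Relation.Nullary.Decidable using (_×-dec_)

-- rad n = product of the distinct primes p dividing n (each prime p ∣ n, n ≥ 1,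
-- satisfies p ≤ n, so it suffices to range over 0 … n).
-- Convention: rad 0 = product over primes ≤ 0 = 1 (never used: abc triples are positive).
rad : ℕ → ℕ
rad n = product (filter (λ p → prime? p ×-dec (p ∣? n)) (upTo (suc n)))

IsAbcTriple : ℕ → ℕ → ℕ → Set
IsAbcTriple a b c =
  a > 0 × b > 0 × c > 0 ×
  Coprime a b × Coprime b c × Coprime a c ×
  a + b ≡ c × rad (a * b * c) < c

-- Write c = d + 1 and S = 1 + c + ⋯ + c^(k-1), so that c^k - 1 = d·S.  A prime dividing
-- (c^k - 1)·c^k divides d, c or S, hence rad((c^k - 1)·c^k) ≤ rad(d·c)·S.  The abc
-- hypothesis for (1, d, c) says rad(d·c) < c, i.e. rad(d·c) ≤ d, and therefore
-- rad((c^k - 1)·c^k) ≤ d·S = c^k - 1 < c^k.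
module Submission where

open import Defs
open import Data.Nat.Base
open import Data.Nat.Properties
open import Data.Nat.Divisibility
open import Data.Nat.Primality
open import Data.Nat.Coprimality using (Coprime; coprime-+; 1-coprimeTo)
import Data.Nat.Coprimality as Coprime
open import Data.Nat.ListAction using (product)
open import Data.Nat.ListAction.Properties using (∈⇒∣product)
open import Data.List.Base using (List; []; _∷_; filter; upTo)
open import Data.List.Membership.Propositional using (_∈_)
open import Data.List.Membership.Propositional.Properties using (∈-filter⁺; ∈-upTo⁺)
open import Data.List.Relation.Unary.Any using (here; there)
open import Data.List.Relation.Unary.All as All using (All; []; _∷_)
open import Data.List.Relation.Unary.All.Properties using (all-filter)
open import Data.List.Relation.Unary.AllPairs using (_∷_)
open import Data.List.Relation.Unary.Unique.Propositional using (Unique)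
import Data.List.Relation.Unary.Unique.Propositional.Properties as Unique
open import Data.Product.Base using (_×_; _,_; proj₁)
open import Data.Sum.Base using (inj₁; inj₂)
open import Relation.Nullary using (contradiction)
open import Relation.Nullary.Decidable using (_×-dec_)
open import Relation.Binary.PropositionalEquality
open import Data.Nat.Solver using (module +-*-Solver)

private
  variable
    m n p q : ℕ

prime⇒≢1 : Prime p → p ≢ 1
prime⇒≢1 pp = nonTrivial⇒≢1 {{prime⇒nonTrivial pp}}

prime∣prime⇒≡ : Prime p → Prime q → p ∣ q → p ≡ q
prime∣prime⇒≡ pp pq p∣q with prime⇒irreducible pq p∣q
... | inj₁ refl = contradiction refl (prime⇒≢1 pp)
... | inj₂ p≡q  = p≡q

prime∣product⇒∈ : ∀ {xs} → Prime p → All Prime xs → p ∣ product xs → p ∈ xs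
prime∣product⇒∈ pp []          p∣1 = contradiction (∣1⇒≡1 p∣1) (prime⇒≢1 pp)
prime∣product⇒∈ pp (px ∷ pxs) p∣x*xs with euclidsLemma _ _ pp p∣x*xs
... | inj₁ p∣x  = here (prime∣prime⇒≡ pp px p∣x)
... | inj₂ p∣xs = there (prime∣product⇒∈ pp pxs p∣xs)

prime∣^⇒prime∣ : ∀ k → Prime p → p ∣ m ^ k → p ∣ m
prime∣^⇒prime∣ zero    pp p∣1 = contradiction (∣1⇒≡1 p∣1) (prime⇒≢1 pp)
prime∣^⇒prime∣ (suc k) pp p∣m*mᵏ with euclidsLemma _ _ pp p∣m*mᵏ
... | inj₁ p∣m  = p∣m
... | inj₂ p∣mᵏ = prime∣^⇒prime∣ k pp p∣mᵏ

product-∣ : ∀ {xs} → Unique xs → All Prime xs → All (_∣ m) xs → product xs ∣ m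
product-∣ {xs = []}     _              _          _              = 1∣ _
product-∣ {xs = x ∷ xs} (x∉xs ∷ !xs) (px ∷ pxs) (x∣m ∷ xs∣m)
  with product-∣ !xs pxs xs∣m
... | divides q refl with euclidsLemma q (product xs) px x∣m
...   | inj₁ x∣q  = *-monoˡ-∣ (product xs) x∣q
...   | inj₂ x∣xs = contradiction refl (All.lookup x∉xs (prime∣product⇒∈ px pxs x∣xs))

coprime-suc : ∀ n → Coprime n (suc n)
coprime-suc n = Coprime.sym (subst (λ m → Coprime m n) (+-comm n 1) (coprime-+ (1-coprimeTo n)))

primeDivisors : ℕ → List ℕ
primeDivisors n = filter (λ p → prime? p ×-dec (p ∣? n)) (upTo (suc n))

primeDivisors-prime×∣ : ∀ n → All (λ p → Prime p × p ∣ n) (primeDivisors n)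
primeDivisors-prime×∣ n = all-filter (λ p → prime? p ×-dec (p ∣? n)) (upTo (suc n))

rad-∣ : (∀ {p} → Prime p → p ∣ n → p ∣ m) → rad n ∣ m
rad-∣ {n} p∣n⇒p∣m = product-∣
  (Unique.filter⁺ (λ p → prime? p ×-dec (p ∣? n)) (Unique.upTo⁺ (suc n)))
  (All.map proj₁ (primeDivisors-prime×∣ n))
  (All.map (λ (pp , p∣n) → p∣n⇒p∣m pp p∣n) (primeDivisors-prime×∣ n))

∣⇒∣rad : .{{NonZero n}} → Prime p → p ∣ n → p ∣ rad n
∣⇒∣rad {n} pp p∣n = ∈⇒∣product
  (∈-filter⁺ (λ p → prime? p ×-dec (p ∣? n)) (∈-upTo⁺ (s≤s (∣⇒≤ p∣n))) (pp , p∣n))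

rad-nonZero : ∀ n → NonZero (rad n)
rad-nonZero n = productOfPrimes≢0 (All.map proj₁ (primeDivisors-prime×∣ n))

isAbcTriple⇒rad< : IsAbcTriple 1 n (suc n) → rad (n * suc n) < suc n
isAbcTriple⇒rad< {n} (_ , _ , _ , _ , _ , _ , _ , rad<) =
  subst (λ m → rad (m * suc n) < suc n) (*-identityˡ n) rad<

rad<⇒isAbcTriple : n > 0 → rad (n * suc n) < suc n → IsAbcTriple 1 n (suc n)
rad<⇒isAbcTriple {n} n>0 rad< =
  z<s , n>0 , z<s , 1-coprimeTo n , coprime-suc n , 1-coprimeTo (suc n) , refl ,
  subst (λ m → rad (m * suc n) < suc n) (sym (*-identityˡ n)) rad<

geometricSum : ℕ → ℕ → ℕ
geometricSum c zero    = 0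
geometricSum c (suc k) = 1 + c * geometricSum c k

suc^≡1+*geometricSum : ∀ d k → suc d ^ k ≡ 1 + d * geometricSum (suc d) k
suc^≡1+*geometricSum d zero    = cong suc (sym (*-zeroʳ d))
suc^≡1+*geometricSum d (suc k) = begin
  suc d * suc d ^ k                     ≡⟨ cong (suc d *_) (suc^≡1+*geometricSum d k) ⟩
  suc d * (1 + d * S)                   ≡⟨ solve 2 (λ d S → (con 1 :+ d) :* (con 1 :+ d :* S)
                                             := con 1 :+ d :* (con 1 :+ (con 1 :+ d) :* S)) refl d S ⟩
  1 + d * (1 + suc d * S)               ∎
  where
  open ≡-Reasoning
  open +-*-Solver
  S = geometricSum (suc d) k

rad[pow∸1*pow]∣rad[d*c]*geometricSum : ∀ d k .{{_ : NonZero d}} →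
  let S = geometricSum (suc d) k in rad (d * S * suc (d * S)) ∣ rad (d * suc d) * S
rad[pow∸1*pow]∣rad[d*c]*geometricSum d k = rad-∣ ∣dS*c^k⇒∣rad*S
  where
  S = geometricSum (suc d) k

  ∣d*c⇒∣rad*S : Prime p → p ∣ d * suc d → p ∣ rad (d * suc d) * S
  ∣d*c⇒∣rad*S pp p∣d*c = ∣m⇒∣m*n S (∣⇒∣rad {{m*n≢0 d (suc d)}} pp p∣d*c)

  ∣dS*c^k⇒∣rad*S : Prime p → p ∣ d * S * suc (d * S) → p ∣ rad (d * suc d) * S
  ∣dS*c^k⇒∣rad*S pp p∣ with euclidsLemma (d * S) (suc (d * S)) pp p∣
  ... | inj₂ p∣cᵏ = ∣d*c⇒∣rad*S pp (∣n⇒∣m*n d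
    (prime∣^⇒prime∣ k pp (subst (_ ∣_) (sym (suc^≡1+*geometricSum d k)) p∣cᵏ)))
  ... | inj₁ p∣d*S with euclidsLemma d S pp p∣d*S
  ...   | inj₁ p∣d = ∣d*c⇒∣rad*S pp (∣m⇒∣m*n (suc d) p∣d)
  ...   | inj₂ p∣S = ∣n⇒∣m*n (rad (d * suc d)) p∣S

corollary2p4 : (c : ℕ) → c > 1 → IsAbcTriple 1 (c ∸ 1) c →
    (k : ℕ) → k > 0 → IsAbcTriple 1 (c ^ k ∸ 1) (c ^ k)
corollary2p4 (suc (suc e)) _ abc (suc j) _ =
  subst (λ n → IsAbcTriple 1 (n ∸ 1) n) (sym (suc^≡1+*geometricSum d k))
    (rad<⇒isAbcTriple z<s rad[dS*c^k]<c^k)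
  where
  open ≤-Reasoning
  d = suc e
  k = suc j
  S = geometricSum (suc d) k

  instance
    rad[d*c]*S≢0 : NonZero (rad (d * suc d) * S)
    rad[d*c]*S≢0 = m*n≢0 (rad (d * suc d)) S {{rad-nonZero (d * suc d)}}

  rad[dS*c^k]<c^k : rad (d * S * suc (d * S)) < suc (d * S)
  rad[dS*c^k]<c^k = begin-strict
    rad (d * S * suc (d * S))  ≤⟨ ∣⇒≤ (rad[pow∸1*pow]∣rad[d*c]*geometricSum d k) ⟩
    rad (d * suc d) * S        ≤⟨ *-monoˡ-≤ S (s≤s⁻¹ (isAbcTriple⇒rad< abc)) ⟩
    d * S                      <⟨ n<1+n (d * S) ⟩
    suc (d * S)                ∎
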